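{- The following recursion holds: \begin{equation*} \begin{aligned} &Q_{0{\bm{v}},0{\bm{w}}}=t^{ -|{\bm{v}}|}Q_{{\bm{v}}\times,{\bm{w}}\times}+qt^{ -|{\bm{v}}|}Q_{{\bm{v}}0,{\bm{w}}0},\\ &Q_{\times{\bm{v}},0{\bm{w}}}=Q_{{\bm{v}}\times,{\bm{w}}\bullet},\\ &Q_{0{\bm{v}},\times{\bm{w}}}=Q_{{\bm{v}}\bullet,{\bm{w}}\times},\\ &Q_{\times{\bm{v}},\times{\bm{w}}}=t^{|{\bm{v}}|}Q_{{\bm{v}}\bullet,{\bm{w}}\bullet},\\ &Q_{\bullet{\bm{v}},\bullet{\bm{w}}}=Q_{{\bm{v}}\bullet,{\bm{w}}\bullet}. \end{aligned} \end{equation*}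
   Context: Let $M,N$ be positive integers, $I_{M,N}$ the set of subsets $\Delta\subset\mathbb{Z}_{\ge0}$ with $\Delta+N\subset\Delta$, $\Delta+M\subset\Delta$ and finite complement $\overline{\Delta}$. Let $\lambda(\Delta)$ be the number of $N$-generators ($a\in\Delta$, $a-N\notin\Delta$) in $[N,N+M-1]$. Define $\mathrm{area}'(\Delta)=\sharp(\overline{\Delta}\cap\mathbb{Z}_{\ge N+M})$ and $\mathrm{codinv}'(\Delta)=\sum_{a\ N\text{ -generator}}\sharp([a,a+M-1]\cap\overline{\Delta}\cap\mathbb{Z}_{\ge N+M})-\lambda(\Delta)(\lambda(\Delta)-1)/2$. For admissible $\mathbf{u}\in\{0,1\}^{N+M}$ (i.e. $I_{\mathbf{u}}=\{\Delta\in I_{M,N}:\forall\,0\le i<N+M,\ i\in\Delta\Leftrightarrow u_i=1\}\ne\emptyset$), $Q_{\mathbf{u}}(q,t)=\sum_{\Delta\in I_{\mathbf{u}}}t^{ -\mathrm{codinv}'(\Delta)}q^{\mathrm{area}'(\Delta)}$, and $Q_{\bm{v},\bm{w}}:=Q_{\mathbf{u}}$ where $\bm{v}\in\{0,\bullet,\times\}^M$ has $v_i=0$ if $u_{N+i}=0$, $\bullet$ if $u_{N+i}=u_i=1$, $\times$ if $u_{N+i}=1,u_i=0$, and $\bm{w}\in\{0,\bullet,\times\}^N$ is defined likewise with $M$ in place of $N$. $|\bm{v}|$ is the number of $\times$'s in $\bm{v}$. -}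

module Defs where

open import Data.Bool using (Bool; true; false; _∧_; _∨_; not; if_then_else_)
open import Data.Nat using (ℕ; zero; suc; _+_; _*_; _∸_; _/_; _<ᵇ_; _≤ᵇ_; _≟_)
open import Data.Integer as ℤ using (ℤ; +_)
open import Data.Fin using (Fin; toℕ)
open import Data.Vec as Vec using (Vec; []; _∷_; tabulate)
open import Data.List as List using (List; []; _∷_; length; filter; upTo; map; _++_)
open import Data.Product using (_×_; _,_)
open import Relation.Nullary.Decidable using (_×-dec_)
open import Relation.Binary.PropositionalEquality using (_≡_; refl)
open import Relation.Binary using (DecidableEquality)
import Data.Vec.Properties as VecP
import Data.Bool.Properties as BoolP

data Sym : Set where
  ○ ● ✕ : Sym

_≟S_ : DecidableEquality Sym
○ ≟S ○ = Relation.Nullary.yes refl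
  where import Relation.Nullary
● ≟S ● = Relation.Nullary.yes refl
  where import Relation.Nullary
✕ ≟S ✕ = Relation.Nullary.yes refl
  where import Relation.Nullary
○ ≟S ● = Relation.Nullary.no (λ ())
  where import Relation.Nullary
○ ≟S ✕ = Relation.Nullary.no (λ ())
  where import Relation.Nullary
● ≟S ○ = Relation.Nullary.no (λ ())
  where import Relation.Nullary
● ≟S ✕ = Relation.Nullary.no (λ ())
  where import Relation.Nullary
✕ ≟S ○ = Relation.Nullary.no (λ ())
  where import Relation.Nullary
✕ ≟S ● = Relation.Nullary.no (λ ())
  where import Relation.Nullary

∣_∣✕ : ∀ {k} → Vec Sym k → ℕ
∣ [] ∣✕ = 0
∣ ✕ ∷ v ∣✕ = suc ∣ v ∣✕
∣ ○ ∷ v ∣✕ = ∣ v ∣✕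
∣ ● ∷ v ∣✕ = ∣ v ∣✕

-- A subset Δ ⊆ ℤ≥0 containing every integer ≥ B is encoded by the vector
-- d : Vec Bool B of its membership bits on [0, B).  Distinct vectors give
-- distinct sets.

mem : ∀ {B} → Vec Bool B → ℕ → Bool
mem []      x       = true
mem (b ∷ d) zero    = b
mem (b ∷ d) (suc x) = mem d x

allVecs : (B : ℕ) → List (Vec Bool B)
allVecs zero    = [] ∷ []
allVecs (suc B) = map (true ∷_) (allVecs B) ++ map (false ∷_) (allVecs B)

countRange : (ℕ → Bool) → ℕ → ℕ → ℕ
countRange f lo zero      = 0
countRange f lo (suc len) = (if f lo then 1 else 0) + countRange f (suc lo) len

sumBelow : (ℕ → ℕ) → ℕ → ℕ
sumBelow g zero      = 0
sumBelow g (suc len) = sumBelow g len + g len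

allBelow : (ℕ → Bool) → ℕ → Bool
allBelow f zero      = true
allBelow f (suc len) = allBelow f len ∧ f len

module _ (M N : ℕ) {B : ℕ} (d : Vec Bool B) where

  private
    Δ : ℕ → Bool
    Δ = mem d

  -- Δ + N ⊆ Δ and Δ + M ⊆ Δ  (only x < B needs checking: Δ ⊇ [B,∞))
  closed : Bool
  closed = allBelow (λ x → not (Δ x) ∨ (Δ (x + N) ∧ Δ (x + M))) B

  sym : Bool → Bool → Sym
  sym false _     = ○
  sym true  true  = ●
  sym true  false = ✕

  vcode : Vec Sym M
  vcode = tabulate (λ i → sym (Δ (N + toℕ i)) (Δ (toℕ i)))

  wcode : Vec Sym N
  wcode = tabulate (λ j → sym (Δ (M + toℕ j)) (Δ (toℕ j)))

  -- area' = ♯(complement ∩ ℤ≥(N+M)); the complement lies below B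
  area′ : ℕ
  area′ = countRange (λ x → not (Δ x)) (N + M) (B ∸ (N + M))

  -- a is an N-generator: a ∈ Δ and a - N ∉ Δ (a - N < 0 counts as ∉ Δ)
  isGen : ℕ → Bool
  isGen a = Δ a ∧ (if a <ᵇ N then true else not (Δ (a ∸ N)))

  lam : ℕ
  lam = countRange isGen N M

  -- Σ over N-generators a of ♯([a, a+M-1] ∩ complement ∩ ℤ≥(N+M));
  -- every N-generator is < B + N
  genSum : ℕ
  genSum = sumBelow
    (λ a → if isGen a
             then countRange (λ y → not (Δ y) ∧ ((N + M) ≤ᵇ y)) a M
             else 0)
    (B + N)

  codinv′ : ℤ
  codinv′ = + genSum ℤ.- + (lam * (lam ∸ 1) / 2)

-- Formal series in q (ℕ-exponents) and t (ℤ-exponents): coefficient maps.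

PS : Set
PS = ℕ → ℤ → ℕ

tPow : ℤ → PS → PS
tPow k f a c = f a (c ℤ.- k)

qMul : PS → PS
qMul f zero    c = 0
qMul f (suc a) c = f a c

_⊕_ : PS → PS → PS
(f ⊕ g) a c = f a c + g a c

infix 4 _≈PS_
_≈PS_ : PS → PS → Set
f ≈PS g = ∀ a c → f a c ≡ g a c

-- Any Δ ∈ I_{M,N} with area'(Δ) = a has complement contained in
-- [0, N (N + M + a)): x ∉ Δ forces x - kN ∉ Δ, so ⌊x/N⌋+1 ≤ ♯complement ≤ N+M+a.
bound : ℕ → ℕ → ℕ → ℕ
bound M N a = N * (N + M + a)

-- Q_{v,w} = Σ_{Δ ∈ I_{M,N}, (v(Δ),w(Δ)) = (v,w)} t^{-codinv'(Δ)} q^{area'(Δ)};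
-- coefficient of q^a t^c.
Q : (M N : ℕ) → Vec Sym M → Vec Sym N → PS
Q M N v w a c = length (filter P? (allVecs (bound M N a)))
  where
  P? : (d : Vec Bool (bound M N a)) → _
  P? d = BoolP._≟_ (closed M N d) true
         ×-dec (VecP.≡-dec _≟S_ (vcode M N d) v
         ×-dec (VecP.≡-dec _≟S_ (wcode M N d) w
         ×-dec ((area′ M N d ≟ a)
         ×-dec (ℤ._≟_ (ℤ.- codinv′ M N d) c))))

module Submission where

-- Write Δ′ = {x | x + 1 ∈ Δ}. A set Δ is recovered from Δ′ and whether 0 ∈ Δ, and it lies in
-- I_{M,N} iff Δ′ does and 0 ∈ Δ implies N, M ∈ Δ. The shift moves the word u by one letter:
-- v and w lose their first letters and gain letters recording N + M together with M, resp. N.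
-- Closedness allows exactly six patterns for the membership of 0, N, M and N + M; these are
-- the six terms of the recursion, the first line being split according to N + M ∈ Δ. The
-- shift lowers area′ by one exactly when N + M ∉ Δ. The |v| N-generators of Δ in (N, N + M)
-- all have N + M in their window [a, a + M), so the generator sum in codinv′ drops by |v|
-- when N + M ∉ Δ, while λ changes by [N + M is an N-generator] − [N is an N-generator];
-- together with λ(λ − 1)/2 this moves the t-exponent by |v|, 0 or −|v|.

open import Data.Bool using (Bool; true; false; not; _∧_; _∨_; if_then_else_; T)
import Data.Bool.Properties as Boolₚ
open import Data.Empty using (⊥-elim)
open import Data.Fin using (toℕ)
open import Data.Integer as ℤ using (ℤ; +_)
import Data.Integer.Properties as ℤₚ
open import Algebra.Properties.AbelianGroup ℤₚ.+-0-abelianGroup using (∙-cancelʳ; ⁻¹-anti-homo‿-)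
open import Data.Integer.Tactic.RingSolver renaming (solve-∀ to solveℤ-∀)
open import Data.List using ([]; _∷_; length; filter; map; _++_)
open import Data.List.Properties using (filter-++; length-++; filter-≐; filter-none)
import Data.List.Relation.Unary.All as All
open import Data.Nat
open import Data.Nat.DivMod using (+-distrib-/-∣ʳ; m*n/n≡m)
open import Data.Nat.Divisibility using (divides)
open import Data.Nat.Properties
open import Algebra.Properties.CommutativeSemigroup +-commutativeSemigroup using (interchange)
open import Data.Nat.Tactic.RingSolver using (solve-∀)
open import Data.Product using (_×_; _,_; proj₁; proj₂)
open import Data.Sum using (inj₁; inj₂)
open import Data.Vec using (Vec; []; _∷_; _∷ʳ_; tabulate)
import Data.Vec.Properties as Vecₚ
open import Function using (_∘_; _⇔_; mk⇔; Equivalence)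
open import Level using (0ℓ)
open import Relation.Binary.Definitions using (tri<; tri≈; tri>)
open import Relation.Binary.PropositionalEquality
open import Relation.Nullary using (¬_; yes; no; does)
open import Relation.Nullary.Decidable using (_×-dec_)
open import Relation.Unary using (Pred; Decidable)
open import Defs using (Sym; ○; ●; ✕; ∣_∣✕; mem; allVecs; countRange; sumBelow; allBelow; PS; tPow; qMul; _⊕_; _≈PS_; bound; Q)
import Defs

𝟙 : Bool → ℕ
𝟙 b = if b then 1 else 0

T⇒≡true : ∀ {b} → T b → b ≡ true
T⇒≡true = Equivalence.to Boolₚ.T-≡

¬T⇒≡false : ∀ {b} → ¬ T b → b ≡ false
¬T⇒≡false {false} _  = refl
¬T⇒≡false {true}  ¬t = ⊥-elim (¬t _)

≤ᵇ-true : ∀ {m n} → m ≤ n → (m ≤ᵇ n) ≡ true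
≤ᵇ-true = T⇒≡true ∘ ≤⇒≤ᵇ

≤ᵇ-false : ∀ {m n} → n < m → (m ≤ᵇ n) ≡ false
≤ᵇ-false {m} {n} n<m = ¬T⇒≡false (<⇒≱ n<m ∘ ≤ᵇ⇒≤ m n)

<ᵇ-true : ∀ {m n} → m < n → (m <ᵇ n) ≡ true
<ᵇ-true = T⇒≡true ∘ <⇒<ᵇ

<ᵇ-false : ∀ {m n} → n ≤ m → (m <ᵇ n) ≡ false
<ᵇ-false {m} {n} n≤m = ¬T⇒≡false (≤⇒≯ n≤m ∘ <ᵇ⇒< m n)

true≢false : true ≢ false
true≢false ()

∧≡true : ∀ {x y} → x ∧ y ≡ true → x ≡ true × y ≡ true
∧≡true {true} {true} _ = refl , refl

implied-∧ : ∀ {a} b → (a ≡ true → b ≡ true) → b ∧ a ≡ a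
implied-∧ {true}  b a⇒b = cong (_∧ true) (a⇒b refl)
implied-∧ {false} b _   = Boolₚ.∧-zeroʳ b

∨-implication : ∀ {a b} → not a ∨ b ≡ true → a ≡ true → b ≡ true
∨-implication {true} b≡true refl = b≡true

implication-∨ : ∀ a {b} → (a ≡ true → b ≡ true) → not a ∨ b ≡ true
implication-∨ false a⇒b = refl
implication-∨ true  a⇒b = a⇒b refl

if-zero : ∀ b {k} → k ≡ 0 → (if b then k else 0) ≡ 0
if-zero true  k≡0 = k≡0
if-zero false _   = refl

𝟙-∧-≤ᵇ-split : ∀ b p z → 𝟙 (b ∧ (p ≤ᵇ z)) ≡ 𝟙 (b ∧ (suc p ≤ᵇ z)) + 𝟙 (b ∧ (z ≡ᵇ p))
𝟙-∧-≤ᵇ-split false p z = refl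
𝟙-∧-≤ᵇ-split true  p z = split p z
  where
  split : ∀ p z → 𝟙 (p ≤ᵇ z) ≡ 𝟙 (suc p ≤ᵇ z) + 𝟙 (z ≡ᵇ p)
  split zero          zero    = refl
  split zero          (suc z) = refl
  split (suc p)       zero    = refl
  split (suc zero)    (suc z) = split zero z
  split (suc (suc p)) (suc z) = split (suc p) z

inRange : ℕ → ℕ → ℕ → Bool
inRange lo len x = (lo ≤ᵇ x) ∧ (x <ᵇ lo + len)

TrueFrom : ℕ → (ℕ → Bool) → Set
TrueFrom B D = ∀ x → B ≤ x → D x ≡ true

countRange-cong : ∀ {f g : ℕ → Bool} lo len → (∀ x → lo ≤ x → x < lo + len → f x ≡ g x) →
                  countRange f lo len ≡ countRange g lo len
countRange-cong lo zero      f≗g = refl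
countRange-cong lo (suc len) f≗g =
  cong₂ _+_ (cong 𝟙 (f≗g lo ≤-refl (m<m+n lo z<s)))
            (countRange-cong (suc lo) len (λ x lo<x x<end → f≗g x (<⇒≤ lo<x) (subst (x <_) (sym (+-suc lo len)) x<end)))

countRange-∘suc : ∀ (f : ℕ → Bool) lo len → countRange (f ∘ suc) lo len ≡ countRange f (suc lo) len
countRange-∘suc f lo zero      = refl
countRange-∘suc f lo (suc len) = cong (_+_ (𝟙 (f (suc lo)))) (countRange-∘suc f (suc lo) len)

countRange-from0 : ∀ (f : ℕ → Bool) lo len → countRange f lo len ≡ countRange (λ x → f (lo + x)) 0 len
countRange-from0 f zero     len = refl
countRange-from0 f (suc lo) len = trans (sym (countRange-∘suc f lo len)) (countRange-from0 (f ∘ suc) lo len)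

countRange-+ : ∀ (f : ℕ → Bool) lo a b → countRange f lo (a + b) ≡ countRange f lo a + countRange f (lo + a) b
countRange-+ f lo zero    b = cong (λ z → countRange f z b) (sym (+-identityʳ lo))
countRange-+ f lo (suc a) b = begin
    𝟙 (f lo) + countRange f (suc lo) (a + b)
  ≡⟨ cong (_+_ (𝟙 (f lo))) (countRange-+ f (suc lo) a b) ⟩
    𝟙 (f lo) + (countRange f (suc lo) a + countRange f (suc lo + a) b)
  ≡⟨ sym (+-assoc (𝟙 (f lo)) _ _) ⟩
    𝟙 (f lo) + countRange f (suc lo) a + countRange f (suc lo + a) b
  ≡⟨ cong (λ z → 𝟙 (f lo) + countRange f (suc lo) a + countRange f z b) (sym (+-suc lo a)) ⟩
    𝟙 (f lo) + countRange f (suc lo) a + countRange f (lo + suc a) b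
  ∎
  where open ≡-Reasoning

countRange-snoc : ∀ (f : ℕ → Bool) lo len → countRange f lo (suc len) ≡ countRange f lo len + 𝟙 (f (lo + len))
countRange-snoc f lo len = begin
  countRange f lo (suc len)                     ≡⟨ cong (countRange f lo) (+-comm 1 len) ⟩
  countRange f lo (len + 1)                     ≡⟨ countRange-+ f lo len 1 ⟩
  countRange f lo len + (𝟙 (f (lo + len)) + 0)  ≡⟨ cong (_+_ (countRange f lo len)) (+-identityʳ _) ⟩
  countRange f lo len + 𝟙 (f (lo + len))        ∎
  where open ≡-Reasoning

last≤countRange : ∀ (f : ℕ → Bool) lo len → 𝟙 (f (lo + len)) ≤ countRange f lo (suc len)
last≤countRange f lo len = ≤-trans (m≤n+m _ _) (≤-reflexive (sym (countRange-snoc f lo len)))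

countRange-mono : ∀ (f : ℕ → Bool) lo {len len′} → len ≤ len′ → countRange f lo len ≤ countRange f lo len′
countRange-mono f lo {len} {len′} len≤len′ = begin
  countRange f lo len                                        ≤⟨ m≤m+n _ _ ⟩
  countRange f lo len + countRange f (lo + len) (len′ ∸ len) ≡⟨ sym (countRange-+ f lo len (len′ ∸ len)) ⟩
  countRange f lo (len + (len′ ∸ len))                       ≡⟨ cong (countRange f lo) (m+[n∸m]≡n len≤len′) ⟩
  countRange f lo len′                                       ∎
  where open ≤-Reasoning

countRange-none : ∀ (f : ℕ → Bool) lo len → (∀ x → lo ≤ x → x < lo + len → f x ≡ false) → countRange f lo len ≡ 0
countRange-none f lo zero      none = refl
countRange-none f lo (suc len) none rewrite none lo ≤-refl (m<m+n lo z<s) =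
  countRange-none f (suc lo) len (λ x lo<x x<end → none x (<⇒≤ lo<x) (subst (x <_) (sym (+-suc lo len)) x<end))

countRange-stable : ∀ (f : ℕ → Bool) {K} lo {len len′} → (∀ x → K ≤ x → f x ≡ false) →
                    K ≤ lo + len → len ≤ len′ → countRange f lo len′ ≡ countRange f lo len
countRange-stable f {K} lo {len} {len′} none K≤end len≤len′ = begin
    countRange f lo len′
  ≡⟨ cong (countRange f lo) (sym (m+[n∸m]≡n len≤len′)) ⟩
    countRange f lo (len + (len′ ∸ len))
  ≡⟨ countRange-+ f lo len (len′ ∸ len) ⟩
    countRange f lo len + countRange f (lo + len) (len′ ∸ len)
  ≡⟨ cong (_+_ (countRange f lo len)) (countRange-none f (lo + len) (len′ ∸ len) (λ x end≤x _ → none x (≤-trans K≤end end≤x))) ⟩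
    countRange f lo len + 0
  ≡⟨ +-identityʳ _ ⟩
    countRange f lo len
  ∎
  where open ≡-Reasoning

countRange-pointwise-+ : ∀ (f g h : ℕ → Bool) lo len → (∀ x → 𝟙 (f x) ≡ 𝟙 (g x) + 𝟙 (h x)) →
                         countRange f lo len ≡ countRange g lo len + countRange h lo len
countRange-pointwise-+ f g h lo zero      split = refl
countRange-pointwise-+ f g h lo (suc len) split =
  trans (cong₂ _+_ (split lo) (countRange-pointwise-+ f g h (suc lo) len split))
        (interchange (𝟙 (g lo)) (𝟙 (h lo)) _ _)

countRange-point : ∀ (f : ℕ → Bool) p lo len → lo ≤ p → p < lo + len → (∀ x → x ≢ p → f x ≡ false) →
                   countRange f lo len ≡ 𝟙 (f p)
countRange-point f p lo zero      lo≤p p<lo  off = ⊥-elim (<⇒≱ p<lo (subst (_≤ p) (sym (+-identityʳ lo)) lo≤p))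
countRange-point f p lo (suc len) lo≤p p<end off with m≤n⇒m<n∨m≡n lo≤p
... | inj₂ refl =
  trans (cong (_+_ (𝟙 (f lo))) (countRange-none f (suc lo) len (λ x lo<x _ → off x (≢-sym (<⇒≢ lo<x)))))
        (+-identityʳ _)
... | inj₁ lo<p =
  trans (cong (λ b → 𝟙 b + countRange f (suc lo) len) (off lo (<⇒≢ lo<p)))
        (countRange-point f p (suc lo) len lo<p (subst (p <_) (+-suc lo len) p<end) off)

sumBelow-cong : ∀ {g h : ℕ → ℕ} len → (∀ x → x < len → g x ≡ h x) → sumBelow g len ≡ sumBelow h len
sumBelow-cong zero      g≗h = refl
sumBelow-cong (suc len) g≗h = cong₂ _+_ (sumBelow-cong len (λ x x<len → g≗h x (m<n⇒m<1+n x<len))) (g≗h len ≤-refl)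

sumBelow-suc : ∀ (g : ℕ → ℕ) len → sumBelow g (suc len) ≡ g 0 + sumBelow (g ∘ suc) len
sumBelow-suc g zero      = +-comm 0 (g 0)
sumBelow-suc g (suc len) = trans (cong (_+ g (suc len)) (sumBelow-suc g len)) (+-assoc (g 0) _ _)

sumBelow-+ : ∀ (g h : ℕ → ℕ) len → sumBelow (λ x → g x + h x) len ≡ sumBelow g len + sumBelow h len
sumBelow-+ g h zero      = refl
sumBelow-+ g h (suc len) =
  trans (cong (_+ (g len + h len)) (sumBelow-+ g h len)) (interchange (sumBelow g len) _ _ _)

sumBelow-*ˡ : ∀ e (g : ℕ → ℕ) len → sumBelow (λ x → e * g x) len ≡ e * sumBelow g len
sumBelow-*ˡ e g zero      = sym (*-zeroʳ e)
sumBelow-*ˡ e g (suc len) = trans (cong (_+ e * g len) (sumBelow-*ˡ e g len)) (sym (*-distribˡ-+ e _ _))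

sumBelow-none : ∀ (g : ℕ → ℕ) len → (∀ x → x < len → g x ≡ 0) → sumBelow g len ≡ 0
sumBelow-none g len none = trans (sumBelow-cong len none) (zeros len)
  where
  zeros : ∀ len → sumBelow (λ _ → 0) len ≡ 0
  zeros zero      = refl
  zeros (suc len) = trans (+-identityʳ _) (zeros len)

sumBelow-stable : ∀ (g : ℕ → ℕ) {K} len → (∀ x → K ≤ x → g x ≡ 0) → K ≤ len → sumBelow g len ≡ sumBelow g K
sumBelow-stable g {K} len none K≤len = trans (cong (sumBelow g) (sym (m+[n∸m]≡n K≤len))) (extend (len ∸ K))
  where
  extend : ∀ j → sumBelow g (K + j) ≡ sumBelow g K
  extend zero    = cong (sumBelow g) (+-identityʳ K)
  extend (suc j) = begin
    sumBelow g (K + suc j)         ≡⟨ cong (sumBelow g) (+-suc K j) ⟩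
    sumBelow g (K + j) + g (K + j) ≡⟨ cong₂ _+_ (extend j) (none (K + j) (m≤m+n K j)) ⟩
    sumBelow g K + 0               ≡⟨ +-identityʳ _ ⟩
    sumBelow g K                   ∎
    where open ≡-Reasoning

sumBelow-inRange : ∀ (f : ℕ → Bool) lo len K → lo + len ≤ K →
                   sumBelow (λ x → 𝟙 (f x ∧ inRange lo len x)) K ≡ countRange f lo len
sumBelow-inRange f lo len K end≤K = trans (sumBelow-stable S K outside end≤K) (partial len ≤-refl)
  where
  S : ℕ → ℕ
  S x = 𝟙 (f x ∧ inRange lo len x)
  outside : ∀ x → lo + len ≤ x → S x ≡ 0
  outside x end≤x rewrite <ᵇ-false end≤x | Boolₚ.∧-zeroʳ (lo ≤ᵇ x) | Boolₚ.∧-zeroʳ (f x) = refl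
  before : ∀ x → x < lo → S x ≡ 0
  before x x<lo rewrite ≤ᵇ-false x<lo | Boolₚ.∧-zeroʳ (f x) = refl
  partial : ∀ j → j ≤ len → sumBelow S (lo + j) ≡ countRange f lo j
  partial zero    _     = trans (cong (sumBelow S) (+-identityʳ lo)) (sumBelow-none S lo before)
  partial (suc j) j<len = begin
    sumBelow S (lo + suc j)            ≡⟨ cong (sumBelow S) (+-suc lo j) ⟩
    sumBelow S (lo + j) + S (lo + j)   ≡⟨ cong₂ _+_ (partial j (<⇒≤ j<len)) (cong 𝟙 inside) ⟩
    countRange f lo j + 𝟙 (f (lo + j)) ≡⟨ sym (countRange-snoc f lo j) ⟩
    countRange f lo (suc j)            ∎
    where
    open ≡-Reasoning
    inside : f (lo + j) ∧ inRange lo len (lo + j) ≡ f (lo + j)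
    inside rewrite ≤ᵇ-true (m≤m+n lo j) | <ᵇ-true (+-monoʳ-< lo j<len) = Boolₚ.∧-identityʳ _

allBelow⇒ : ∀ (f : ℕ → Bool) len → allBelow f len ≡ true → ∀ x → x < len → f x ≡ true
allBelow⇒ f (suc len) all x x<1+len with ∧≡true {allBelow f len} all | m≤n⇒m<n∨m≡n (≤-pred x<1+len)
... | below , _    | inj₁ x<len = allBelow⇒ f len below x x<len
... | _     , last | inj₂ refl  = last

⇒allBelow : ∀ (f : ℕ → Bool) len → (∀ x → x < len → f x ≡ true) → allBelow f len ≡ true
⇒allBelow f zero      all = refl
⇒allBelow f (suc len) all rewrite ⇒allBelow f len (λ x x<len → all x (m<n⇒m<1+n x<len)) | all len ≤-refl = refl

triangle : ℕ → ℕ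
triangle x = x * (x ∸ 1) / 2

triangle-suc : ∀ x → triangle (suc x) ≡ triangle x + x
triangle-suc x = begin
  suc x * x / 2               ≡⟨ cong (_/ 2) (double x) ⟩
  (x * (x ∸ 1) + x * 2) / 2   ≡⟨ +-distrib-/-∣ʳ (x * (x ∸ 1)) (divides x refl) ⟩
  triangle x + x * 2 / 2      ≡⟨ cong (_+_ (triangle x)) (m*n/n≡m x 2) ⟩
  triangle x + x              ∎
  where
  open ≡-Reasoning
  double : ∀ x → suc x * x ≡ x * (x ∸ 1) + x * 2
  double zero    = refl
  double (suc y) = expand y
    where
    expand : ∀ y → suc (suc y) * suc y ≡ suc y * y + suc y * 2
    expand = solve-∀

countVecs : ∀ {B} {P : Pred (Vec Bool B) 0ℓ} → Decidable P → ℕ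
countVecs {B} P? = length (filter P? (allVecs B))

length-filter-++ : ∀ {A : Set} {P : Pred A 0ℓ} (P? : Decidable P) xs ys →
                   length (filter P? (xs ++ ys)) ≡ length (filter P? xs) + length (filter P? ys)
length-filter-++ P? xs ys = trans (cong length (filter-++ P? xs ys)) (length-++ (filter P? xs))

length-filter-map : ∀ {A C : Set} {P : Pred C 0ℓ} (P? : Decidable P) (f : A → C) xs →
                    length (filter P? (map f xs)) ≡ length (filter (P? ∘ f) xs)
length-filter-map P? f []       = refl
length-filter-map P? f (x ∷ xs) with does (P? (f x))
... | true  = cong suc (length-filter-map P? f xs)
... | false = length-filter-map P? f xs

module _ {B : ℕ} {P P′ : Pred (Vec Bool B) 0ℓ} (P? : Decidable P) (P′? : Decidable P′) where

  countVecs-cong : (∀ d → P d → P′ d) → (∀ d → P′ d → P d) → countVecs P? ≡ countVecs P′?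
  countVecs-cong to from = cong length (filter-≐ P? P′? ((λ {d} → to d) , (λ {d} → from d)) (allVecs B))

countVecs-none : ∀ {B} {P : Pred (Vec Bool B) 0ℓ} (P? : Decidable P) → (∀ d → ¬ P d) → countVecs P? ≡ 0
countVecs-none {B} P? none = cong length (filter-none P? {allVecs B} (All.tabulate (λ {d} _ → none d)))

countVecs-split : ∀ {B} {P : Pred (Vec Bool B) 0ℓ} (P? : Decidable P) (g : Vec Bool B → Bool) →
                  countVecs P? ≡ countVecs (λ d → P? d ×-dec (g d Boolₚ.≟ true))
                                 + countVecs (λ d → P? d ×-dec (g d Boolₚ.≟ false))
countVecs-split {B} P? g = split (allVecs B)
  where
  split : ∀ ds → length (filter P? ds) ≡ length (filter (λ d → P? d ×-dec (g d Boolₚ.≟ true)) ds)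
                                         + length (filter (λ d → P? d ×-dec (g d Boolₚ.≟ false)) ds)
  split []       = refl
  split (d ∷ ds) with P? d | g d
  ... | yes _ | true  = cong suc (split ds)
  ... | yes _ | false = trans (cong suc (split ds)) (sym (+-suc _ _))
  ... | no  _ | true  = split ds
  ... | no  _ | false = split ds

countVecs-∷ : ∀ {B} {P : Pred (Vec Bool (suc B)) 0ℓ} (P? : Decidable P) →
              countVecs P? ≡ countVecs (P? ∘ (true ∷_)) + countVecs (P? ∘ (false ∷_))
countVecs-∷ {B} P? =
  trans (length-filter-++ P? (map (true ∷_) (allVecs B)) _)
        (cong₂ _+_ (length-filter-map P? (true ∷_) (allVecs B)) (length-filter-map P? (false ∷_) (allVecs B)))

countVecs-∷ʳ : ∀ {B} {P : Pred (Vec Bool (suc B)) 0ℓ} (P? : Decidable P) →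
               countVecs P? ≡ countVecs (λ xs → P? (xs ∷ʳ true)) + countVecs (λ xs → P? (xs ∷ʳ false))
countVecs-∷ʳ {zero}  P? = trans (countVecs-∷ P?) (cong₂ _+_ (last true) (last false))
  where
  -- Vec Bool 0 has no η-rule, so b ∷ xs and xs ∷ʳ b only agree after matching xs with [].
  last : ∀ b → countVecs (P? ∘ (b ∷_)) ≡ countVecs (λ xs → P? (xs ∷ʳ b))
  last b = countVecs-cong (P? ∘ (b ∷_)) (λ xs → P? (xs ∷ʳ b)) (λ { [] p → p }) (λ { [] p → p })
countVecs-∷ʳ {suc B} P? = begin
    countVecs P?
  ≡⟨ countVecs-∷ P? ⟩
    countVecs (P? ∘ (true ∷_)) + countVecs (P? ∘ (false ∷_))
  ≡⟨ cong₂ _+_ (countVecs-∷ʳ (P? ∘ (true ∷_))) (countVecs-∷ʳ (P? ∘ (false ∷_))) ⟩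
    (tt + tf) + (ft + ff)
  ≡⟨ interchange tt tf ft ff ⟩
    (tt + ft) + (tf + ff)
  ≡⟨ cong₂ _+_ (sym (countVecs-∷ (λ xs → P? (xs ∷ʳ true)))) (sym (countVecs-∷ (λ xs → P? (xs ∷ʳ false)))) ⟩
    countVecs (λ xs → P? (xs ∷ʳ true)) + countVecs (λ xs → P? (xs ∷ʳ false))
  ∎
  where
  open ≡-Reasoning
  tt tf ft ff : ℕ
  tt = countVecs (λ xs → P? (true ∷ (xs ∷ʳ true)))
  tf = countVecs (λ xs → P? (true ∷ (xs ∷ʳ false)))
  ft = countVecs (λ xs → P? (false ∷ (xs ∷ʳ true)))
  ff = countVecs (λ xs → P? (false ∷ (xs ∷ʳ false)))

module _ {B : ℕ} {P : Pred (Vec Bool (suc B)) 0ℓ} (P? : Decidable P) where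

  countVecs-head : ∀ b → (∀ x xs → P (x ∷ xs) → x ≡ b) → countVecs P? ≡ countVecs (P? ∘ (b ∷_))
  countVecs-head true  head = begin
    countVecs P?                                              ≡⟨ countVecs-∷ P? ⟩
    countVecs (P? ∘ (true ∷_)) + countVecs (P? ∘ (false ∷_))  ≡⟨ cong (_+_ (countVecs (P? ∘ (true ∷_)))) (countVecs-none _ none) ⟩
    countVecs (P? ∘ (true ∷_)) + 0                            ≡⟨ +-identityʳ _ ⟩
    countVecs (P? ∘ (true ∷_))                                ∎
    where
    open ≡-Reasoning
    none : ∀ xs → ¬ P (false ∷ xs)
    none xs p = true≢false (sym (head false xs p))
  countVecs-head false head =
    trans (countVecs-∷ P?) (cong (_+ countVecs (P? ∘ (false ∷_))) (countVecs-none _ none))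
    where
    none : ∀ xs → ¬ P (true ∷ xs)
    none xs p = true≢false (head true xs p)

  countVecs-last : (∀ xs x → P (xs ∷ʳ x) → x ≡ true) → countVecs P? ≡ countVecs (λ xs → P? (xs ∷ʳ true))
  countVecs-last last =
    trans (countVecs-∷ʳ P?) (trans (cong (_+_ (countVecs (λ xs → P? (xs ∷ʳ true)))) (countVecs-none _ none)) (+-identityʳ _))
    where
    none : ∀ xs → ¬ P (xs ∷ʳ false)
    none xs p = true≢false (sym (last xs false p))

mem-trueFrom : ∀ {B} (d : Vec Bool B) → TrueFrom B (mem d)
mem-trueFrom []      x       _         = refl
mem-trueFrom (b ∷ d) (suc x) (s≤s B≤x) = mem-trueFrom d x B≤x

mem-∷ʳ-true : ∀ {B} (d : Vec Bool B) → mem (d ∷ʳ true) ≗ mem d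
mem-∷ʳ-true []      zero    = refl
mem-∷ʳ-true []      (suc x) = refl
mem-∷ʳ-true (b ∷ d) zero    = refl
mem-∷ʳ-true (b ∷ d) (suc x) = mem-∷ʳ-true d x

mem-∷ʳ-last : ∀ {B} (d : Vec Bool B) x → mem (d ∷ʳ x) B ≡ x
mem-∷ʳ-last []      x = refl
mem-∷ʳ-last (b ∷ d) x = mem-∷ʳ-last d x

tabulateℕ : ∀ {A : Set} k → (ℕ → A) → Vec A k
tabulateℕ zero    f = []
tabulateℕ (suc k) f = f 0 ∷ tabulateℕ k (f ∘ suc)

tabulate-toℕ : ∀ {A : Set} k (f : ℕ → A) → tabulate {n = k} (f ∘ toℕ) ≡ tabulateℕ k f
tabulate-toℕ zero    f = refl
tabulate-toℕ (suc k) f = cong (f 0 ∷_) (tabulate-toℕ k (f ∘ suc))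

tabulateℕ-cong : ∀ {A : Set} k {f g : ℕ → A} → (∀ i → i < k → f i ≡ g i) → tabulateℕ k f ≡ tabulateℕ k g
tabulateℕ-cong zero    f≗g = refl
tabulateℕ-cong (suc k) f≗g = cong₂ _∷_ (f≗g 0 z<s) (tabulateℕ-cong k (λ i i<k → f≗g (suc i) (s<s i<k)))

tabulateℕ-∷ʳ : ∀ {A : Set} k (f : ℕ → A) → tabulateℕ (suc k) f ≡ tabulateℕ k f ∷ʳ f k
tabulateℕ-∷ʳ zero    f = refl
tabulateℕ-∷ʳ (suc k) f = cong (f 0 ∷_) (tabulateℕ-∷ʳ k (f ∘ suc))

symbol : Bool → Bool → Sym
symbol false _     = ○
symbol true  true  = ●
symbol true  false = ✕

Defs-sym≡symbol : ∀ {M N B} (d : Vec Bool B) x y → Defs.sym M N d x y ≡ symbol x y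
Defs-sym≡symbol d false _     = refl
Defs-sym≡symbol d true  true  = refl
Defs-sym≡symbol d true  false = refl

symbol-injectiveˡ : ∀ {x y x′ y′} → symbol x y ≡ symbol x′ y′ → x ≡ x′
symbol-injectiveˡ {x} {y} {x′} {y′} eq = trans (sym (present-symbol x y)) (trans (cong present eq) (present-symbol x′ y′))
  where
  present : Sym → Bool
  present ○ = false
  present _ = true
  present-symbol : ∀ x y → present (symbol x y) ≡ x
  present-symbol false _     = refl
  present-symbol true  true  = refl
  present-symbol true  false = refl

symbol-injective-∧ : ∀ {x y x′ y′} → symbol x y ≡ symbol x′ y′ → x ∧ y ≡ x′ ∧ y′
symbol-injective-∧ {x} {y} {x′} {y′} eq = trans (sym (bullet-symbol x y)) (trans (cong bullet eq) (bullet-symbol x′ y′))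
  where
  bullet : Sym → Bool
  bullet ● = true
  bullet _ = false
  bullet-symbol : ∀ x y → bullet (symbol x y) ≡ x ∧ y
  bullet-symbol false _     = refl
  bullet-symbol true  true  = refl
  bullet-symbol true  false = refl

∣tabulateℕ-symbol∣✕ : ∀ k (f g : ℕ → Bool) →
                      ∣ tabulateℕ k (λ i → symbol (f i) (g i)) ∣✕ ≡ countRange (λ i → f i ∧ not (g i)) 0 k
∣tabulateℕ-symbol∣✕ zero    f g = refl
∣tabulateℕ-symbol∣✕ (suc k) f g =
  trans (head (f 0) (g 0) _)
        (cong (_+_ (𝟙 (f 0 ∧ not (g 0)))) (trans (∣tabulateℕ-symbol∣✕ k (f ∘ suc) (g ∘ suc)) (countRange-∘suc _ 0 k)))
  where
  head : ∀ {k} x y (v : Vec Sym k) → ∣ symbol x y ∷ v ∣✕ ≡ 𝟙 (x ∧ not y) + ∣ v ∣✕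
  head false _     v = refl
  head true  true  v = refl
  head true  false v = refl

-- The six corner patterns

-- The memberships of 0, N, M and N + M in a set Δ ∈ I_{M,N} (bit₀, bitN, bitM, bitNM) form
-- one of these six patterns. Each is named after the first letters of v and w that it
-- produces; for ○○ the membership of N + M is free and recorded by ∈ / ∉.
data Corner : Set where
  ○○∈ ○○∉ ✕○ ○✕ ✕✕ ●● : Corner

bit₀ bitN bitM bitNM : Corner → Bool
bit₀ ●● = true
bit₀ _  = false

bitN ✕○ = true
bitN ✕✕ = true
bitN ●● = true
bitN _  = false

bitM ○✕ = true
bitM ✕✕ = true
bitM ●● = true
bitM _  = false

bitNM ○○∉ = false
bitNM _   = true

headV headW lastV lastW : Corner → Sym
headV κ = symbol (bitN κ) (bit₀ κ)
headW κ = symbol (bitM κ) (bit₀ κ)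
lastV κ = symbol (bitNM κ) (bitM κ)
lastW κ = symbol (bitNM κ) (bitN κ)

corner-closed₀ : ∀ κ → bit₀ κ ≡ true → bitN κ ≡ true × bitM κ ≡ true
corner-closed₀ ●● _ = refl , refl

corner-closedNM : ∀ κ → bitN κ ∨ bitM κ ≡ true → bitNM κ ≡ true
corner-closedNM ○○∈ _ = refl
corner-closedNM ✕○  _ = refl
corner-closedNM ○✕  _ = refl
corner-closedNM ✕✕  _ = refl
corner-closedNM ●●  _ = refl

tShift : Corner → ℕ → ℤ
tShift ○○∈ k = + k
tShift ○○∉ k = + k
tShift ✕○  _ = + 0
tShift ○✕  _ = + 0
tShift ✕✕  k = ℤ.- + k
tShift ●●  _ = + 0

diff-shift⁺ : ∀ {a b c d} k → a + d ≡ c + b + k → + a ℤ.- + b ≡ (+ c ℤ.- + d) ℤ.+ + k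
diff-shift⁺ {a} {b} {c} {d} k eq = begin
    + a ℤ.- + b
  ≡⟨ regroup (+ a) (+ b) (+ c) (+ d) (+ k) ⟩
    (+ c ℤ.- + d) ℤ.+ + k ℤ.+ ((+ a ℤ.+ + d) ℤ.- (+ c ℤ.+ + b ℤ.+ + k))
  ≡⟨ cong (λ z → (+ c ℤ.- + d) ℤ.+ + k ℤ.+ (z ℤ.- (+ c ℤ.+ + b ℤ.+ + k))) sums ⟩
    (+ c ℤ.- + d) ℤ.+ + k ℤ.+ ((+ c ℤ.+ + b ℤ.+ + k) ℤ.- (+ c ℤ.+ + b ℤ.+ + k))
  ≡⟨ cong (ℤ._+_ ((+ c ℤ.- + d) ℤ.+ + k)) (ℤₚ.+-inverseʳ (+ c ℤ.+ + b ℤ.+ + k)) ⟩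
    (+ c ℤ.- + d) ℤ.+ + k ℤ.+ + 0
  ≡⟨ ℤₚ.+-identityʳ _ ⟩
    (+ c ℤ.- + d) ℤ.+ + k
  ∎
  where
  open ≡-Reasoning
  regroup : ∀ A B C D K → A ℤ.- B ≡ (C ℤ.- D) ℤ.+ K ℤ.+ ((A ℤ.+ D) ℤ.- (C ℤ.+ B ℤ.+ K))
  regroup = solveℤ-∀
  sums : + a ℤ.+ + d ≡ + c ℤ.+ + b ℤ.+ + k
  sums = trans (sym (ℤₚ.pos-+ a d)) (trans (cong +_ eq) (trans (ℤₚ.pos-+ (c + b) k) (cong (ℤ._+ + k) (ℤₚ.pos-+ c b))))

diff-shift⁻ : ∀ {a b c d} k → a + d + k ≡ c + b → + a ℤ.- + b ≡ (+ c ℤ.- + d) ℤ.- + k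
diff-shift⁻ {a} {b} {c} {d} k eq = begin
  + a ℤ.- + b                    ≡⟨ undo (+ a ℤ.- + b) (+ k) ⟩
  (+ a ℤ.- + b) ℤ.+ + k ℤ.- + k  ≡⟨ cong (ℤ._- + k) (sym (diff-shift⁺ {c} {d} {a} {b} k (sym eq))) ⟩
  (+ c ℤ.- + d) ℤ.- + k          ∎
  where
  open ≡-Reasoning
  undo : ∀ X K → X ≡ X ℤ.+ K ℤ.- K
  undo = solveℤ-∀

-- λD, λE and GD, GE stand for λ and the generator sum of a set and of its shift.
codinv-arith : ∀ κ k {λD λE GD GE} →
               λD ≡ 𝟙 (bitN κ ∧ not (bit₀ κ)) + k → λE ≡ 𝟙 (bitNM κ ∧ not (bitM κ)) + k →
               GD ≡ GE + 𝟙 (not (bitNM κ)) * λE →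
               + triangle λE ℤ.- + GE ≡ (+ triangle λD ℤ.- + GD) ℤ.+ tShift κ k
codinv-arith ○○∈ k {GE = G} refl refl refl =
  diff-shift⁺ {triangle (suc k)} {G} {triangle k} {G + 0} k
    (trans (cong (_+ (G + 0)) (triangle-suc k)) (identity (triangle k) G k))
  where
  identity : ∀ t g k → t + k + (g + 0) ≡ t + g + k
  identity = solve-∀
codinv-arith ○○∉ k {GE = G} refl refl refl =
  diff-shift⁺ {triangle k} {G} {triangle k} {G + 1 * k} k (identity (triangle k) G k)
  where
  identity : ∀ t g k → t + (g + 1 * k) ≡ t + g + k
  identity = solve-∀
codinv-arith ✕○ k {GE = G} refl refl refl =
  diff-shift⁺ {triangle (suc k)} {G} {triangle (suc k)} {G + 0} 0 (sym (+-assoc (triangle (suc k)) G 0))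
codinv-arith ○✕ k {GE = G} refl refl refl =
  diff-shift⁺ {triangle k} {G} {triangle k} {G + 0} 0 (sym (+-assoc (triangle k) G 0))
codinv-arith ●● k {GE = G} refl refl refl =
  diff-shift⁺ {triangle k} {G} {triangle k} {G + 0} 0 (sym (+-assoc (triangle k) G 0))
codinv-arith ✕✕ k {GE = G} refl refl refl =
  diff-shift⁻ {triangle k} {G} {triangle (suc k)} {G + 0} k
    (trans (identity (triangle k) G k) (cong (_+ G) (sym (triangle-suc k))))
  where
  identity : ∀ t g k → t + (g + 0) + k ≡ t + k + g
  identity = solve-∀

-- Statistics of a set given by its indicator function

module _ (m n : ℕ) where

  private
    M N : ℕ
    M = suc m
    N = suc n

  Closed : (ℕ → Bool) → Set
  Closed D = ∀ x → D x ≡ true → D (x + N) ≡ true × D (x + M) ≡ true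

  -- Indices are added on the left (i + N, not N + i as in Defs) so that the words of D and of
  -- D ∘ suc share their tails definitionally.
  vword : (ℕ → Bool) → Vec Sym M
  vword D = tabulateℕ M (λ i → symbol (D (i + N)) (D i))

  wword : (ℕ → Bool) → Vec Sym N
  wword D = tabulateℕ N (λ j → symbol (D (j + M)) (D j))

  area : (ℕ → Bool) → ℕ → ℕ
  area D B = countRange (λ x → not (D x)) (N + M) (B ∸ (N + M))

  isGen : (ℕ → Bool) → ℕ → Bool
  isGen D a = D a ∧ (if a <ᵇ N then true else not (D (a ∸ N)))

  lam : (ℕ → Bool) → ℕ
  lam D = countRange (isGen D) N M

  window : (ℕ → Bool) → ℕ → ℕ
  window D a = countRange (λ y → not (D y) ∧ ((N + M) ≤ᵇ y)) a M

  genWeight : (ℕ → Bool) → ℕ → ℕ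
  genWeight D a = if isGen D a then window D a else 0

  genSum : (ℕ → Bool) → ℕ → ℕ
  genSum D B = sumBelow (genWeight D) (B + N)

  codinv : (ℕ → Bool) → ℕ → ℤ
  codinv D B = + genSum D B ℤ.- + triangle (lam D)

  Contributes : ℕ → ℕ → ℤ → Vec Sym M → Vec Sym N → (ℕ → Bool) → Set
  Contributes B a c v w D = Closed D × vword D ≡ v × wword D ≡ w × area D B ≡ a × ℤ.- codinv D B ≡ c

  Term : (B a : ℕ) (c : ℤ) → Vec Sym M → Vec Sym N → Pred (Vec Bool B) 0ℓ
  Term B a c v w d = Defs.closed M N d ≡ true × (Defs.vcode M N d ≡ v × (Defs.wcode M N d ≡ w ×
                     (Defs.area′ M N d ≡ a × ℤ.- Defs.codinv′ M N d ≡ c)))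

  -- This is verbatim the decision procedure filtered in Q, so Q M N v w a c computes to
  -- countVecs (term? (bound M N a) a c v w).
  term? : ∀ B a c v w → Decidable (Term B a c v w)
  term? B a c v w d = Boolₚ._≟_ (Defs.closed M N d) true
    ×-dec (Vecₚ.≡-dec Defs._≟S_ (Defs.vcode M N d) v
    ×-dec (Vecₚ.≡-dec Defs._≟S_ (Defs.wcode M N d) w
    ×-dec ((Defs.area′ M N d ≟ a)
    ×-dec (ℤ._≟_ (ℤ.- Defs.codinv′ M N d) c))))

  termNM? : ∀ B a c v w r → Decidable (λ d → Term B a c v w d × mem d (N + M) ≡ r)
  termNM? B a c v w r d = term? B a c v w d ×-dec (mem d (N + M) Boolₚ.≟ r)

  module _ {B : ℕ} (d : Vec Bool B) where

    closed⇒Closed : Defs.closed M N d ≡ true → Closed (mem d)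
    closed⇒Closed closed x x∈d with x <? B
    ... | yes x<B = ∧≡true (∨-implication (allBelow⇒ _ B closed x x<B) x∈d)
    ... | no  x≮B = mem-trueFrom d (x + N) (≤-trans (≮⇒≥ x≮B) (m≤m+n x N)) ,
                    mem-trueFrom d (x + M) (≤-trans (≮⇒≥ x≮B) (m≤m+n x M))

    Closed⇒closed : Closed (mem d) → Defs.closed M N d ≡ true
    Closed⇒closed closed = ⇒allBelow _ B (λ x _ → implication-∨ (mem d x) (λ x∈d → both (closed x x∈d)))
      where
      both : ∀ {a b} → a ≡ true × b ≡ true → a ∧ b ≡ true
      both (refl , refl) = refl

    vcode≡vword : Defs.vcode M N d ≡ vword (mem d)
    vcode≡vword = begin
        tabulate (λ i → Defs.sym M N d (mem d (N + toℕ i)) (mem d (toℕ i)))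
      ≡⟨ Vecₚ.tabulate-cong (λ i → Defs-sym≡symbol {M} {N} d (mem d (N + toℕ i)) (mem d (toℕ i))) ⟩
        tabulate (λ i → symbol (mem d (N + toℕ i)) (mem d (toℕ i)))
      ≡⟨ tabulate-toℕ M (λ i → symbol (mem d (N + i)) (mem d i)) ⟩
        tabulateℕ M (λ i → symbol (mem d (N + i)) (mem d i))
      ≡⟨ tabulateℕ-cong M (λ i _ → cong (λ j → symbol (mem d j) (mem d i)) (+-comm N i)) ⟩
        vword (mem d)
      ∎
      where open ≡-Reasoning

    wcode≡wword : Defs.wcode M N d ≡ wword (mem d)
    wcode≡wword = begin
        tabulate (λ j → Defs.sym M N d (mem d (M + toℕ j)) (mem d (toℕ j)))
      ≡⟨ Vecₚ.tabulate-cong (λ j → Defs-sym≡symbol {M} {N} d (mem d (M + toℕ j)) (mem d (toℕ j))) ⟩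
        tabulate (λ j → symbol (mem d (M + toℕ j)) (mem d (toℕ j)))
      ≡⟨ tabulate-toℕ N (λ j → symbol (mem d (M + j)) (mem d j)) ⟩
        tabulateℕ N (λ j → symbol (mem d (M + j)) (mem d j))
      ≡⟨ tabulateℕ-cong N (λ j _ → cong (λ i → symbol (mem d i) (mem d j)) (+-comm M j)) ⟩
        wword (mem d)
      ∎
      where open ≡-Reasoning

    Term⇒Contributes : ∀ {a c v w} → Term B a c v w d → Contributes B a c v w (mem d)
    Term⇒Contributes (closed , v≡ , w≡ , area≡ , codinv≡) =
      closed⇒Closed closed , trans (sym vcode≡vword) v≡ , trans (sym wcode≡wword) w≡ , area≡ , codinv≡

    Contributes⇒Term : ∀ {a c v w} → Contributes B a c v w (mem d) → Term B a c v w d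
    Contributes⇒Term (closed , v≡ , w≡ , area≡ , codinv≡) =
      Closed⇒closed closed , trans vcode≡vword v≡ , trans wcode≡wword w≡ , area≡ , codinv≡

  module _ {D D′ : ℕ → Bool} (D≗D′ : D ≗ D′) where

    Closed-≗ : Closed D → Closed D′
    Closed-≗ closed x x∈D′ with closed x (trans (D≗D′ x) x∈D′)
    ... | x+N∈D , x+M∈D = trans (sym (D≗D′ (x + N))) x+N∈D , trans (sym (D≗D′ (x + M))) x+M∈D

    isGen-≗ : ∀ a → isGen D a ≡ isGen D′ a
    isGen-≗ a = cong₂ _∧_ (D≗D′ a) (cong (λ b → if a <ᵇ N then true else not b) (D≗D′ (a ∸ N)))

    codinv-≗ : ∀ B → codinv D B ≡ codinv D′ B
    codinv-≗ B = cong₂ (λ g l → + g ℤ.- + triangle l) genSum≡ lam≡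
      where
      window≡ : ∀ a → window D a ≡ window D′ a
      window≡ a = countRange-cong a M (λ y _ _ → cong (λ b → not b ∧ ((N + M) ≤ᵇ y)) (D≗D′ y))
      genSum≡ : genSum D B ≡ genSum D′ B
      genSum≡ = sumBelow-cong (B + N) (λ a _ → cong₂ (λ b k → if b then k else 0) (isGen-≗ a) (window≡ a))
      lam≡ : lam D ≡ lam D′
      lam≡ = countRange-cong N M (λ x _ _ → isGen-≗ x)

    Contributes-≗ : ∀ {B a c v w} → Contributes B a c v w D → Contributes B a c v w D′
    Contributes-≗ {B} (closed , v≡ , w≡ , area≡ , codinv≡) =
      Closed-≗ closed ,
      trans (tabulateℕ-cong M (λ i _ → cong₂ symbol (sym (D≗D′ (i + N))) (sym (D≗D′ i)))) v≡ ,
      trans (tabulateℕ-cong N (λ j _ → cong₂ symbol (sym (D≗D′ (j + M))) (sym (D≗D′ j)))) w≡ ,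
      trans (countRange-cong (N + M) (B ∸ (N + M)) (λ x _ _ → cong not (sym (D≗D′ x)))) area≡ ,
      trans (cong ℤ.-_ (sym (codinv-≗ B))) codinv≡

  isGen-beyond : ∀ {B D} → TrueFrom B D → ∀ a → B + N ≤ a → isGen D a ≡ false
  isGen-beyond {B} {D} D-true a B+N≤a
    rewrite <ᵇ-false {a} {N} (≤-trans (m≤n+m N B) B+N≤a)
          | D-true (a ∸ N) (subst (_≤ a ∸ N) (m+n∸n≡m B N) (∸-monoˡ-≤ N B+N≤a)) = Boolₚ.∧-zeroʳ (D a)

  module _ {B : ℕ} {D : ℕ → Bool} (D-true : TrueFrom B D) where

    area-pad : area D (suc B) ≡ area D B
    area-pad = countRange-stable (λ x → not (D x)) (N + M) (λ x B≤x → cong not (D-true x B≤x))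
                 (m≤n+m∸n B (N + M)) (∸-monoˡ-≤ (N + M) (n≤1+n B))

    genSum-pad : genSum D (suc B) ≡ genSum D B
    genSum-pad = sumBelow-stable (genWeight D) (suc B + N) weightless (n≤1+n (B + N))
      where
      weightless : ∀ a → B + N ≤ a → genWeight D a ≡ 0
      weightless a B+N≤a rewrite isGen-beyond D-true a B+N≤a = refl

    codinv-pad : codinv D (suc B) ≡ codinv D B
    codinv-pad = cong (λ g → + g ℤ.- + triangle (lam D)) genSum-pad

    Contributes-pad : ∀ {a c v w} → Contributes (suc B) a c v w D ⇔ Contributes B a c v w D
    Contributes-pad = mk⇔
      (λ (closed , v≡ , w≡ , area≡ , codinv≡) →
         closed , v≡ , w≡ , trans (sym area-pad) area≡ , trans (cong ℤ.-_ (sym codinv-pad)) codinv≡)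
      (λ (closed , v≡ , w≡ , area≡ , codinv≡) →
         closed , v≡ , w≡ , trans area-pad area≡ , trans (cong ℤ.-_ codinv-pad) codinv≡)

  -- A gap y of a closed set forces the gaps y − N, y − 2N, …, so a gap beyond bound M N a
  -- would leave more than a gaps in [N + M, ∞).
  module _ {D : ℕ → Bool} (closed : Closed D) where

    private
      absent : ℕ → Bool
      absent x = not (D x)
      missing : ℕ → ℕ
      missing y = countRange absent (N + M) (suc y ∸ (N + M))

    missing-chain : ∀ k y → D y ≡ false → N + M + k * N ≤ y → suc k ≤ missing y
    missing-chain zero y y∉D lo+0≤y = begin
      1                                              ≡⟨ cong (𝟙 ∘ not) (sym y∉D) ⟩
      𝟙 (absent y)                                   ≡⟨ cong (𝟙 ∘ absent) (sym (m+[n∸m]≡n lo≤y)) ⟩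
      𝟙 (absent (N + M + (y ∸ (N + M))))             ≤⟨ last≤countRange absent (N + M) (y ∸ (N + M)) ⟩
      countRange absent (N + M) (suc (y ∸ (N + M)))  ≡⟨ cong (countRange absent (N + M)) (sym (+-∸-assoc 1 lo≤y)) ⟩
      missing y                                      ∎
      where
      open ≤-Reasoning
      lo≤y : N + M ≤ y
      lo≤y = subst (_≤ y) (+-identityʳ (N + M)) lo+0≤y
    missing-chain (suc k) y y∉D bound≤y = begin
      suc (suc k)                                       ≡⟨ +-comm 1 (suc k) ⟩
      suc k + 1                                         ≤⟨ +-mono-≤ (missing-chain k y′ y′∉D bound≤y′) at-y ⟩
      missing y′ + countRange absent (suc y′) N         ≡⟨ cong (λ z → missing y′ + countRange absent z N) (sym (m+[n∸m]≡n lo≤1+y′)) ⟩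
      missing y′ + countRange absent (N + M + len′) N    ≡⟨ sym (countRange-+ absent (N + M) len′ N) ⟩
      countRange absent (N + M) (len′ + N)               ≡⟨ cong (countRange absent (N + M)) (sym split) ⟩
      missing y                                         ∎
      where
      open ≤-Reasoning
      y′ len′ : ℕ
      y′ = y ∸ N
      len′ = suc y′ ∸ (N + M)
      y′+N≡y : y′ + N ≡ y
      y′+N≡y = m∸n+n≡m (≤-trans (≤-trans (m≤m+n N (k * N)) (m≤n+m (suc k * N) (N + M))) bound≤y)
      y′∉D : D y′ ≡ false
      y′∉D with D y′ in y′∈D
      ... | false = refl
      ... | true  = ⊥-elim (true≢false (trans (sym (proj₁ (closed y′ y′∈D))) (trans (cong D y′+N≡y) y∉D)))
      bound≤y′ : N + M + k * N ≤ y′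
      bound≤y′ = subst (_≤ y′) (m+n∸n≡m (N + M + k * N) N) (∸-monoˡ-≤ N (subst (_≤ y) regroup bound≤y))
        where
        regroup : N + M + suc k * N ≡ N + M + k * N + N
        regroup = trans (cong (_+_ (N + M)) (+-comm N (k * N))) (sym (+-assoc (N + M) (k * N) N))
      lo≤1+y′ : N + M ≤ suc y′
      lo≤1+y′ = ≤-trans (m≤m+n (N + M) (k * N)) (≤-trans bound≤y′ (n≤1+n y′))
      split : suc y ∸ (N + M) ≡ len′ + N
      split = trans (cong (λ z → suc z ∸ (N + M)) (sym y′+N≡y)) (+-∸-comm N lo≤1+y′)
      at-y : 1 ≤ countRange absent (suc y′) N
      at-y = begin
        1                           ≡⟨ cong (𝟙 ∘ not) (sym y∉D) ⟩
        𝟙 (absent y)                ≡⟨ cong (𝟙 ∘ absent) (trans (sym y′+N≡y) (+-suc y′ n)) ⟩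
        𝟙 (absent (suc y′ + n))     ≤⟨ last≤countRange absent (suc y′) n ⟩
        countRange absent (suc y′) N ∎

    complement-bound : ∀ {B a} → TrueFrom B D → area D B ≡ a → TrueFrom (bound M N a) D
    complement-bound {B} {a} D-true area≡a x bound≤x with D x in x∈D
    ... | true  = refl
    ... | false = ⊥-elim (<-irrefl refl (begin-strict
        a          <⟨ missing-chain a x x∈D (≤-trans chain≤bound bound≤x) ⟩
        missing x  ≤⟨ countRange-mono absent (N + M) (∸-monoˡ-≤ (N + M) x<B) ⟩
        area D B   ≡⟨ area≡a ⟩
        a          ∎))
      where
      open ≤-Reasoning
      x<B : x < B
      x<B with B ≤? x
      ... | yes B≤x = ⊥-elim (true≢false (trans (sym (D-true x B≤x)) x∈D))
      ... | no  B≰x = ≰⇒> B≰x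
      chain≤bound : N + M + a * N ≤ bound M N a
      chain≤bound = begin
        N + M + a * N        ≤⟨ +-monoˡ-≤ (a * N) (m≤m*n (N + M) N) ⟩
        (N + M) * N + a * N  ≡⟨ sym (*-distribʳ-+ N (N + M) a) ⟩
        (N + M + a) * N      ≡⟨ *-comm (N + M + a) N ⟩
        bound M N a          ∎

  Contributes-bound : ∀ {B a c v w D} → TrueFrom B D → Contributes B a c v w D → TrueFrom (bound M N a) D
  Contributes-bound D-true (closed , _ , _ , area≡ , _) = complement-bound closed D-true area≡

  Closed-N+M : ∀ {D} → Closed D → D N ∨ D M ≡ true → D (N + M) ≡ true
  Closed-N+M {D} closed N∨M with D N in N∈ | D M in M∈
  ... | true  | _    = proj₂ (closed N N∈)
  ... | false | true = trans (cong D (+-comm N M)) (proj₁ (closed M M∈))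

  N+M≤bound : ∀ a → N + M ≤ bound M N a
  N+M≤bound a = ≤-trans (m≤m+n (N + M) a) (m≤n*m (N + M + a) N)

  bound-mono : ∀ {a a′} → a ≤ a′ → bound M N a ≤ bound M N a′
  bound-mono a≤a′ = *-monoʳ-≤ N (+-monoʳ-≤ (N + M) a≤a′)

  -- Removing the point 0

  module _ (D : ℕ → Bool) where

    private
      E : ℕ → Bool
      E = D ∘ suc
      absent : ℕ → Bool
      absent x = not (D x)
      e : ℕ
      e = 𝟙 (absent (N + M))

    vtail : Vec Sym m
    vtail = tabulateℕ m (λ i → symbol (D (suc i + N)) (D (suc i)))

    wtail : Vec Sym n
    wtail = tabulateℕ n (λ j → symbol (D (suc j + M)) (D (suc j)))

    vword-∘suc : vword E ≡ vtail ∷ʳ symbol (D (N + M)) (D M)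
    vword-∘suc =
      trans (tabulateℕ-∷ʳ m (λ i → symbol (E (i + N)) (E i))) (cong (λ x → vtail ∷ʳ symbol (D x) (D M)) (+-comm M N))

    wword-∘suc : wword E ≡ wtail ∷ʳ symbol (D (N + M)) (D N)
    wword-∘suc = tabulateℕ-∷ʳ n (λ j → symbol (E (j + M)) (E j))

    Closed-∘suc : Closed D → Closed E
    Closed-∘suc closed x = closed (suc x)

    Closed-∷ : Closed E → (D 0 ≡ true → D N ≡ true × D M ≡ true) → Closed D
    Closed-∷ closedE at0 zero    = at0
    Closed-∷ closedE at0 (suc x) = closedE x

    HasCorner : Corner → Set
    HasCorner κ = D 0 ≡ bit₀ κ × D N ≡ bitN κ × D M ≡ bitM κ × D (N + M) ≡ bitNM κ

    corner-from-heads : ∀ {κ} → Closed D → symbol (D N) (D 0) ≡ headV κ → symbol (D M) (D 0) ≡ headW κ →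
                        D (N + M) ≡ bitNM κ → HasCorner κ
    corner-from-heads {κ} closed v₀ w₀ N+M∈ = 0∈ , symbol-injectiveˡ v₀ , symbol-injectiveˡ w₀ , N+M∈
      where
      open ≡-Reasoning
      0∈ : D 0 ≡ bit₀ κ
      0∈ = begin
        D 0              ≡⟨ sym (implied-∧ (D N) (proj₁ ∘ closed 0)) ⟩
        D N ∧ D 0        ≡⟨ symbol-injective-∧ v₀ ⟩
        bitN κ ∧ bit₀ κ  ≡⟨ implied-∧ (bitN κ) (proj₁ ∘ corner-closed₀ κ) ⟩
        bit₀ κ           ∎

    corner-from-lasts : ∀ {κ} → Closed E → symbol (D (N + M)) (D M) ≡ lastV κ → symbol (D (N + M)) (D N) ≡ lastW κ →
                        D 0 ≡ bit₀ κ → HasCorner κ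
    corner-from-lasts {κ} closedE vₗ wₗ 0∈ = 0∈ , N∈ , M∈ , symbol-injectiveˡ vₗ
      where
      open ≡-Reasoning
      M∈ : D M ≡ bitM κ
      M∈ = begin
        D M               ≡⟨ sym (implied-∧ (D (N + M)) (λ M∈D → trans (cong D (+-comm N M)) (proj₁ (closedE m M∈D)))) ⟩
        D (N + M) ∧ D M   ≡⟨ symbol-injective-∧ vₗ ⟩
        bitNM κ ∧ bitM κ  ≡⟨ implied-∧ (bitNM κ) (λ bM → corner-closedNM κ (trans (cong (bitN κ ∨_) bM) (Boolₚ.∨-zeroʳ (bitN κ)))) ⟩
        bitM κ            ∎
      N∈ : D N ≡ bitN κ
      N∈ = begin
        D N               ≡⟨ sym (implied-∧ (D (N + M)) (proj₂ ∘ closedE n)) ⟩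
        D (N + M) ∧ D N   ≡⟨ symbol-injective-∧ wₗ ⟩
        bitNM κ ∧ bitN κ  ≡⟨ implied-∧ (bitNM κ) (λ bN → corner-closedNM κ (cong (_∨ bitM κ) bN)) ⟩
        bitN κ            ∎

    corner-heads : ∀ {κ} → HasCorner κ → symbol (D N) (D 0) ≡ headV κ × symbol (D M) (D 0) ≡ headW κ
    corner-heads (0∈ , N∈ , M∈ , _) = cong₂ symbol N∈ 0∈ , cong₂ symbol M∈ 0∈

    corner-lasts : ∀ {κ} → HasCorner κ → symbol (D (N + M)) (D M) ≡ lastV κ × symbol (D (N + M)) (D N) ≡ lastW κ
    corner-lasts (_ , N∈ , M∈ , N+M∈) = cong₂ symbol N+M∈ M∈ , cong₂ symbol N+M∈ N∈

    corner-closed : ∀ {κ} → HasCorner κ → D 0 ≡ true → D N ≡ true × D M ≡ true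
    corner-closed {κ} (0∈ , N∈ , M∈ , _) 0∈D with corner-closed₀ κ (trans (sym 0∈) 0∈D)
    ... | bN , bM = trans N∈ bN , trans M∈ bM

    area-∘suc : ∀ {L} → N + M ≤ L → TrueFrom (suc L) D → area D (suc L) ≡ e + area E (suc L)
    area-∘suc {L} N+M≤L D-true = begin
        countRange absent (N + M) (suc L ∸ (N + M))
      ≡⟨ cong (countRange absent (N + M)) (+-∸-assoc 1 N+M≤L) ⟩
        e + countRange absent (suc (N + M)) (L ∸ (N + M))
      ≡⟨ cong (_+_ e) (sym (countRange-stable absent (suc (N + M)) beyond
                              (s≤s (m≤n+m∸n L (N + M))) (∸-monoˡ-≤ (N + M) (n≤1+n L)))) ⟩
        e + countRange absent (suc (N + M)) (suc L ∸ (N + M))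
      ≡⟨ cong (_+_ e) (sym (countRange-∘suc absent (N + M) (suc L ∸ (N + M)))) ⟩
        e + area E (suc L)
      ∎
      where
      open ≡-Reasoning
      beyond : ∀ x → suc L ≤ x → absent x ≡ false
      beyond x L<x = cong not (D-true x L<x)

    isGen-N : isGen D N ≡ D N ∧ not (D 0)
    isGen-N rewrite <ᵇ-false {N} {N} ≤-refl | n∸n≡0 N = refl

    isGen-N+M : isGen D (N + M) ≡ D (N + M) ∧ not (D M)
    isGen-N+M rewrite <ᵇ-false {N + M} {N} (m≤m+n N M) | m+n∸m≡n N M = refl

    isGen-∘suc : ∀ a → a ≢ n → isGen E a ≡ isGen D (suc a)
    isGen-∘suc a a≢n with <-cmp a n
    ... | tri< a<n _ _ rewrite <ᵇ-true {a} {N} (m<n⇒m<1+n a<n) | <ᵇ-true {suc a} {N} (s<s a<n) = refl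
    ... | tri≈ _ a≡n _ = ⊥-elim (a≢n a≡n)
    ... | tri> _ _ n<a rewrite <ᵇ-false {a} {N} n<a | <ᵇ-false {suc a} {N} (m<n⇒m<1+n n<a) | +-∸-assoc 1 n<a = refl

    innerGenerators : ℕ
    innerGenerators = countRange (isGen D) (suc N) m

    lam-split : lam D ≡ 𝟙 (D N ∧ not (D 0)) + innerGenerators
    lam-split = cong (λ b → 𝟙 b + innerGenerators) isGen-N

    lam-∘suc : lam E ≡ 𝟙 (D (N + M) ∧ not (D M)) + innerGenerators
    lam-∘suc = begin
      countRange (isGen E) N M                     ≡⟨ countRange-cong N M (λ x N≤x _ → isGen-∘suc x (>⇒≢ N≤x)) ⟩
      countRange (isGen D ∘ suc) N M               ≡⟨ countRange-∘suc (isGen D) N M ⟩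
      countRange (isGen D) (suc N) M               ≡⟨ countRange-snoc (isGen D) (suc N) m ⟩
      innerGenerators + 𝟙 (isGen D (suc N + m))    ≡⟨ +-comm innerGenerators _ ⟩
      𝟙 (isGen D (suc N + m)) + innerGenerators    ≡⟨ cong (λ x → 𝟙 (isGen D x) + innerGenerators) (sym (+-suc N m)) ⟩
      𝟙 (isGen D (N + M)) + innerGenerators        ≡⟨ cong (λ b → 𝟙 b + innerGenerators) isGen-N+M ⟩
      𝟙 (D (N + M) ∧ not (D M)) + innerGenerators  ∎
      where open ≡-Reasoning

    ∣vtail∣✕ : ∣ vtail ∣✕ ≡ innerGenerators
    ∣vtail∣✕ = begin
      ∣ vtail ∣✕                                              ≡⟨ ∣tabulateℕ-symbol∣✕ m (λ i → D (suc i + N)) (D ∘ suc) ⟩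
      countRange (λ i → D (suc i + N) ∧ not (D (suc i))) 0 m  ≡⟨ countRange-cong 0 m (λ i _ _ → sym (inner i)) ⟩
      countRange (λ i → isGen D (suc N + i)) 0 m              ≡⟨ sym (countRange-from0 (isGen D) (suc N) m) ⟩
      innerGenerators                                         ∎
      where
      open ≡-Reasoning
      inner : ∀ i → isGen D (suc N + i) ≡ D (suc i + N) ∧ not (D (suc i))
      inner i rewrite <ᵇ-false {suc N + i} {N} (≤-trans (n≤1+n N) (m≤m+n (suc N) i)) =
        cong₂ (λ x y → D x ∧ not (D y)) (cong suc (+-comm N i)) (trans (cong (_∸ N) (sym (+-suc N i))) (m+n∸m≡n N (suc i)))

    window-early : ∀ a → a ≤ N → window D a ≡ 0
    window-early a a≤N = countRange-none _ a M (λ y _ y<a+M →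
      trans (cong (absent y ∧_) (≤ᵇ-false (<-≤-trans y<a+M (+-monoˡ-≤ M a≤N)))) (Boolₚ.∧-zeroʳ (absent y)))

    window-suc : ∀ a → window D (suc a) ≡ window E a + e * 𝟙 (inRange N M a)
    window-suc a = begin
      window D (suc a)                                      ≡⟨ countRange-pointwise-+ _ later at (suc a) M split ⟩
      countRange later (suc a) M + countRange at (suc a) M  ≡⟨ cong₂ _+_ (sym (countRange-∘suc later a M)) point ⟩
      window E a + e * 𝟙 (inRange N M a)                    ∎
      where
      open ≡-Reasoning
      -- later ∘ suc is window E's predicate: suc (N + M) ≤ᵇ suc y and N + M ≤ᵇ y compute to the same.
      later at : ℕ → Bool
      later y = absent y ∧ (suc (N + M) ≤ᵇ y)
      at y = absent y ∧ (y ≡ᵇ N + M)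
      split : ∀ y → 𝟙 (absent y ∧ ((N + M) ≤ᵇ y)) ≡ 𝟙 (later y) + 𝟙 (at y)
      split y = 𝟙-∧-≤ᵇ-split (absent y) (N + M) y
      elsewhere : ∀ y → y ≢ N + M → at y ≡ false
      elsewhere y y≢ = trans (cong (absent y ∧_) (¬T⇒≡false (y≢ ∘ ≡ᵇ⇒≡ y (N + M)))) (Boolₚ.∧-zeroʳ (absent y))
      point : countRange at (suc a) M ≡ e * 𝟙 (inRange N M a)
      point with N ≤? a | a <? N + M
      ... | yes N≤a | yes a<N+M rewrite ≤ᵇ-true N≤a | <ᵇ-true a<N+M = begin
        countRange at (suc a) M  ≡⟨ countRange-point at (N + M) (suc a) M a<N+M (s≤s (+-monoˡ-≤ M N≤a)) elsewhere ⟩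
        𝟙 (at (N + M))           ≡⟨ cong (λ b → 𝟙 (absent (N + M) ∧ b)) (T⇒≡true (≡⇒≡ᵇ (N + M) (N + M) refl)) ⟩
        𝟙 (absent (N + M) ∧ true) ≡⟨ cong 𝟙 (Boolₚ.∧-identityʳ _) ⟩
        e                        ≡⟨ sym (*-identityʳ e) ⟩
        e * 1                    ∎
      ... | yes N≤a | no a≮N+M rewrite ≤ᵇ-true N≤a | <ᵇ-false (≮⇒≥ a≮N+M) =
        trans (countRange-none at (suc a) M (λ y a<y _ → elsewhere y (≢-sym (<⇒≢ (<-≤-trans (s≤s (≮⇒≥ a≮N+M)) a<y)))))
              (sym (*-zeroʳ e))
      ... | no N≰a | _ rewrite ≤ᵇ-false (≰⇒> N≰a) =
        trans (countRange-none at (suc a) M (λ y _ y<end → elsewhere y (<⇒≢ (<-≤-trans y<end (+-monoˡ-≤ M (≰⇒> N≰a))))))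
              (sym (*-zeroʳ e))

    weight-suc : ∀ a b → (if b then window D (suc a) else 0) ≡ (if b then window E a else 0) + e * 𝟙 (b ∧ inRange N M a)
    weight-suc a true  = window-suc a
    weight-suc a false = sym (*-zeroʳ e)

    genWeight-suc : ∀ a → genWeight D (suc a) ≡ genWeight E a + e * 𝟙 (isGen D (suc a) ∧ inRange N M a)
    genWeight-suc a with a ≟ n
    ... | no a≢n =
      trans (weight-suc a (isGen D (suc a)))
            (cong (λ b → (if b then window E a else 0) + e * 𝟙 (isGen D (suc a) ∧ inRange N M a)) (sym (isGen-∘suc a a≢n)))
    ... | yes refl = trans (if-zero (isGen D N) (window-early N ≤-refl))
                           (sym (cong₂ _+_ (if-zero (isGen E n) windowE≡0) correction≡0))
      where
      windowE≡0 : window E n ≡ 0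
      windowE≡0 = m+n≡0⇒m≡0 (window E n) (trans (sym (window-suc n)) (window-early N ≤-refl))
      correction≡0 : e * 𝟙 (isGen D N ∧ inRange N M n) ≡ 0
      correction≡0 = trans (cong (λ r → e * 𝟙 (isGen D N ∧ (r ∧ (n <ᵇ N + M)))) (≤ᵇ-false {N} {n} ≤-refl))
                           (trans (cong (λ b → e * 𝟙 b) (Boolₚ.∧-zeroʳ (isGen D N))) (*-zeroʳ e))

    module _ {L : ℕ} (N+M≤L : N + M ≤ L) (D-true : TrueFrom (suc L) D) where

      genSum-∘suc : genSum D (suc L) ≡ genSum E (suc L) + e * lam E
      genSum-∘suc = begin
          sumBelow (genWeight D) (suc (L + N))
        ≡⟨ sumBelow-suc (genWeight D) (L + N) ⟩
          genWeight D 0 + sumBelow (genWeight D ∘ suc) (L + N)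
        ≡⟨ cong₂ _+_ (if-zero (isGen D 0) (window-early 0 z≤n)) (sumBelow-cong (L + N) (λ a _ → genWeight-suc a)) ⟩
          sumBelow (λ a → genWeight E a + e * χ a) (L + N)
        ≡⟨ sumBelow-+ (genWeight E) (λ a → e * χ a) (L + N) ⟩
          sumBelow (genWeight E) (L + N) + sumBelow (λ a → e * χ a) (L + N)
        ≡⟨ cong₂ _+_ (sym (genSum-pad E-true)) (sumBelow-*ˡ e χ (L + N)) ⟩
          genSum E (suc L) + e * sumBelow χ (L + N)
        ≡⟨ cong (λ z → genSum E (suc L) + e * z) χ-sum ⟩
          genSum E (suc L) + e * lam E
        ∎
        where
        open ≡-Reasoning
        χ : ℕ → ℕ
        χ a = 𝟙 (isGen D (suc a) ∧ inRange N M a)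
        E-true : TrueFrom L E
        E-true x L≤x = D-true (suc x) (s≤s L≤x)
        χ-sum : sumBelow χ (L + N) ≡ lam E
        χ-sum = begin
          sumBelow χ (L + N)              ≡⟨ sumBelow-inRange (isGen D ∘ suc) N M (L + N) (≤-trans N+M≤L (m≤m+n L N)) ⟩
          countRange (isGen D ∘ suc) N M  ≡⟨ countRange-cong N M (λ x N≤x _ → sym (isGen-∘suc x (>⇒≢ N≤x))) ⟩
          lam E                           ∎

      codinv-∘suc : ∀ {κ} → HasCorner κ → ℤ.- codinv E (suc L) ≡ ℤ.- codinv D (suc L) ℤ.+ tShift κ innerGenerators
      codinv-∘suc {κ} (0∈ , N∈ , M∈ , N+M∈) = begin
          ℤ.- codinv E (suc L)
        ≡⟨ ⁻¹-anti-homo‿- (+ genSum E (suc L)) (+ triangle (lam E)) ⟩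
          + triangle (lam E) ℤ.- + genSum E (suc L)
        ≡⟨ codinv-arith κ innerGenerators lamD lamE genSumD ⟩
          (+ triangle (lam D) ℤ.- + genSum D (suc L)) ℤ.+ tShift κ innerGenerators
        ≡⟨ cong (ℤ._+ tShift κ innerGenerators) (sym (⁻¹-anti-homo‿- (+ genSum D (suc L)) (+ triangle (lam D)))) ⟩
          ℤ.- codinv D (suc L) ℤ.+ tShift κ innerGenerators
        ∎
        where
        open ≡-Reasoning
        lamD : lam D ≡ 𝟙 (bitN κ ∧ not (bit₀ κ)) + innerGenerators
        lamD = trans lam-split (cong₂ (λ x y → 𝟙 (x ∧ not y) + innerGenerators) N∈ 0∈)
        lamE : lam E ≡ 𝟙 (bitNM κ ∧ not (bitM κ)) + innerGenerators
        lamE = trans lam-∘suc (cong₂ (λ x y → 𝟙 (x ∧ not y) + innerGenerators) N+M∈ M∈)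
        genSumD : genSum D (suc L) ≡ genSum E (suc L) + 𝟙 (not (bitNM κ)) * lam E
        genSumD = trans genSum-∘suc (cong (λ b → genSum E (suc L) + 𝟙 (not b) * lam E) N+M∈)

      Contributes-∘suc : ∀ {κ a c v w} →
                         Contributes (suc L) (𝟙 (not (bitNM κ)) + a) c (headV κ ∷ v) (headW κ ∷ w) D → D (N + M) ≡ bitNM κ →
                         Contributes (suc L) a (c ℤ.+ tShift κ ∣ v ∣✕) (v ∷ʳ lastV κ) (w ∷ʳ lastW κ) E
      Contributes-∘suc {κ} {a} {c} {v} {w} (closed , v≡ , w≡ , area≡ , codinv≡) N+M∈ =
        Closed-∘suc closed ,
        trans vword-∘suc (cong₂ _∷ʳ_ vtail≡v (proj₁ (corner-lasts corner))) ,
        trans wword-∘suc (cong₂ _∷ʳ_ (Vecₚ.∷-injectiveʳ w≡) (proj₂ (corner-lasts corner))) ,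
        +-cancelˡ-≡ (𝟙 (not (bitNM κ))) _ _ areas ,
        trans (codinv-∘suc corner) (cong₂ (λ x k → x ℤ.+ tShift κ k) codinv≡ k≡)
        where
        vtail≡v : vtail ≡ v
        vtail≡v = Vecₚ.∷-injectiveʳ v≡
        corner : HasCorner κ
        corner = corner-from-heads closed (Vecₚ.∷-injectiveˡ v≡) (Vecₚ.∷-injectiveˡ w≡) N+M∈
        areas : 𝟙 (not (bitNM κ)) + area E (suc L) ≡ 𝟙 (not (bitNM κ)) + a
        areas = trans (cong (λ b → 𝟙 (not b) + area E (suc L)) (sym N+M∈)) (trans (sym (area-∘suc N+M≤L D-true)) area≡)
        k≡ : innerGenerators ≡ ∣ v ∣✕
        k≡ = trans (sym ∣vtail∣✕) (cong ∣_∣✕ vtail≡v)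

      Contributes-∷ : ∀ {κ a c v w} → D 0 ≡ bit₀ κ →
                      Contributes (suc L) a (c ℤ.+ tShift κ ∣ v ∣✕) (v ∷ʳ lastV κ) (w ∷ʳ lastW κ) E →
                      Contributes (suc L) (𝟙 (not (bitNM κ)) + a) c (headV κ ∷ v) (headW κ ∷ w) D × D (N + M) ≡ bitNM κ
      Contributes-∷ {κ} {a} {c} {v} {w} 0∈ (closedE , v≡ , w≡ , area≡ , codinv≡) =
        (Closed-∷ closedE (corner-closed corner) ,
         cong₂ _∷_ (proj₁ (corner-heads corner)) (proj₁ vlast) ,
         cong₂ _∷_ (proj₂ (corner-heads corner)) (proj₁ wlast) ,
         trans (area-∘suc N+M≤L D-true) (cong₂ (λ b x → 𝟙 (not b) + x) N+M∈ area≡) ,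
         ∙-cancelʳ (tShift κ ∣ v ∣✕) _ _ codinvs) ,
        N+M∈
        where
        vlast : vtail ≡ v × symbol (D (N + M)) (D M) ≡ lastV κ
        vlast = Vecₚ.∷ʳ-injective vtail v (trans (sym vword-∘suc) v≡)
        wlast : wtail ≡ w × symbol (D (N + M)) (D N) ≡ lastW κ
        wlast = Vecₚ.∷ʳ-injective wtail w (trans (sym wword-∘suc) w≡)
        corner : HasCorner κ
        corner = corner-from-lasts closedE (proj₂ vlast) (proj₂ wlast) 0∈
        N+M∈ : D (N + M) ≡ bitNM κ
        N+M∈ = proj₂ (proj₂ (proj₂ corner))
        k≡ : innerGenerators ≡ ∣ v ∣✕
        k≡ = trans (sym ∣vtail∣✕) (cong ∣_∣✕ (proj₁ vlast))
        codinvs : ℤ.- codinv D (suc L) ℤ.+ tShift κ ∣ v ∣✕ ≡ c ℤ.+ tShift κ ∣ v ∣✕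
        codinvs = trans (cong (λ k → ℤ.- codinv D (suc L) ℤ.+ tShift κ k) (sym k≡)) (trans (sym (codinv-∘suc corner)) codinv≡)

  -- Counting contributions

  countVecs-pad : ∀ {B a c v w} → bound M N a ≤ B → countVecs (term? B a c v w) ≡ countVecs (term? (suc B) a c v w)
  countVecs-pad {B} {a} {c} {v} {w} bound≤B =
    sym (trans (countVecs-last (term? (suc B) a c v w) last-true) (countVecs-cong _ _ shrink grow))
    where
    last-true : ∀ xs x → Term (suc B) a c v w (xs ∷ʳ x) → x ≡ true
    last-true xs x t =
      trans (sym (mem-∷ʳ-last xs x)) (Contributes-bound (mem-trueFrom (xs ∷ʳ x)) (Term⇒Contributes (xs ∷ʳ x) t) B bound≤B)
    shrink : ∀ xs → Term (suc B) a c v w (xs ∷ʳ true) → Term B a c v w xs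
    shrink xs t = Contributes⇒Term xs (Equivalence.to (Contributes-pad (mem-trueFrom xs))
      (Contributes-≗ (mem-∷ʳ-true xs) {suc B} (Term⇒Contributes (xs ∷ʳ true) t)))
    grow : ∀ xs → Term B a c v w xs → Term (suc B) a c v w (xs ∷ʳ true)
    grow xs t = Contributes⇒Term (xs ∷ʳ true) (Contributes-≗ (sym ∘ mem-∷ʳ-true xs) {suc B}
      (Equivalence.from (Contributes-pad (mem-trueFrom xs)) (Term⇒Contributes xs t)))

  Q≡countVecs : ∀ {B a c v w} → bound M N a ≤ B → Q M N v w a c ≡ countVecs (term? B a c v w)
  Q≡countVecs {B} {a} {c} {v} {w} bound≤B =
    trans (padded (B ∸ bound M N a)) (cong (λ B′ → countVecs (term? B′ a c v w)) (m∸n+n≡m bound≤B))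
    where
    padded : ∀ j → Q M N v w a c ≡ countVecs (term? (j + bound M N a) a c v w)
    padded zero    = refl
    padded (suc j) = trans (padded j) (countVecs-pad (m≤n+m (bound M N a) j))

  countVecs-corner : ∀ κ {B a c} (v : Vec Sym m) (w : Vec Sym n) → N + M ≤ B → bound M N a ≤ B →
                     countVecs (termNM? (suc B) (𝟙 (not (bitNM κ)) + a) c (headV κ ∷ v) (headW κ ∷ w) (bitNM κ))
                     ≡ countVecs (term? (suc B) a (c ℤ.+ tShift κ ∣ v ∣✕) (v ∷ʳ lastV κ) (w ∷ʳ lastW κ))
  countVecs-corner κ {B} {a} {c} v w N+M≤B bound≤B = begin
    countVecs restricted?                     ≡⟨ countVecs-head restricted? (bit₀ κ) first ⟩
    countVecs (restricted? ∘ (bit₀ κ ∷_))     ≡⟨ countVecs-cong _ (λ xs → shifted? (xs ∷ʳ true)) forward backward ⟩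
    countVecs (λ xs → shifted? (xs ∷ʳ true))  ≡⟨ sym (countVecs-last shifted? last) ⟩
    countVecs shifted?                        ∎
    where
    open ≡-Reasoning
    Restricted Shifted : Pred (Vec Bool (suc B)) 0ℓ
    Restricted d = Term (suc B) (𝟙 (not (bitNM κ)) + a) c (headV κ ∷ v) (headW κ ∷ w) d × mem d (N + M) ≡ bitNM κ
    Shifted = Term (suc B) a (c ℤ.+ tShift κ ∣ v ∣✕) (v ∷ʳ lastV κ) (w ∷ʳ lastW κ)
    restricted? : Decidable Restricted
    restricted? = termNM? (suc B) (𝟙 (not (bitNM κ)) + a) c (headV κ ∷ v) (headW κ ∷ w) (bitNM κ)
    shifted? : Decidable Shifted
    shifted? = term? (suc B) a (c ℤ.+ tShift κ ∣ v ∣✕) (v ∷ʳ lastV κ) (w ∷ʳ lastW κ)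
    first : ∀ x xs → Restricted (x ∷ xs) → x ≡ bit₀ κ
    first x xs (t , N+M∈) with Term⇒Contributes (x ∷ xs) t
    ... | closed , v≡ , w≡ , _ =
      proj₁ (corner-from-heads (mem (x ∷ xs)) closed (Vecₚ.∷-injectiveˡ v≡) (Vecₚ.∷-injectiveˡ w≡) N+M∈)
    forward : ∀ xs → Restricted (bit₀ κ ∷ xs) → Shifted (xs ∷ʳ true)
    forward xs (t , N+M∈) = Contributes⇒Term (xs ∷ʳ true) (Contributes-≗ (sym ∘ mem-∷ʳ-true xs) {suc B}
      (Contributes-∘suc (mem (bit₀ κ ∷ xs)) N+M≤B (mem-trueFrom (bit₀ κ ∷ xs)) (Term⇒Contributes (bit₀ κ ∷ xs) t) N+M∈))
    backward : ∀ xs → Shifted (xs ∷ʳ true) → Restricted (bit₀ κ ∷ xs)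
    backward xs t with Contributes-∷ (mem (bit₀ κ ∷ xs)) N+M≤B (mem-trueFrom (bit₀ κ ∷ xs)) refl
                         (Contributes-≗ (mem-∷ʳ-true xs) {suc B} (Term⇒Contributes (xs ∷ʳ true) t))
    ... | contributes , N+M∈ = Contributes⇒Term (bit₀ κ ∷ xs) contributes , N+M∈
    last : ∀ xs x → Shifted (xs ∷ʳ x) → x ≡ true
    last xs x t =
      trans (sym (mem-∷ʳ-last xs x)) (Contributes-bound (mem-trueFrom (xs ∷ʳ x)) (Term⇒Contributes (xs ∷ʳ x) t) B bound≤B)

  Q-corner : ∀ κ → bitN κ ∨ bitM κ ≡ true → ∀ (v : Vec Sym m) (w : Vec Sym n) a c →
             Q M N (headV κ ∷ v) (headW κ ∷ w) a c ≡ Q M N (v ∷ʳ lastV κ) (w ∷ʳ lastW κ) a (c ℤ.+ tShift κ ∣ v ∣✕)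
  Q-corner κ N∨M v w a c = begin
      Q M N (headV κ ∷ v) (headW κ ∷ w) a c
    ≡⟨ Q≡countVecs (n≤1+n B) ⟩
      countVecs (term? (suc B) a c (headV κ ∷ v) (headW κ ∷ w))
    ≡⟨ countVecs-cong _ _ (λ d t → t , forced d t) (λ _ → proj₁) ⟩
      countVecs (termNM? (suc B) a c (headV κ ∷ v) (headW κ ∷ w) true)
    ≡⟨ subst (λ b → countVecs (termNM? (suc B) (𝟙 (not b) + a) c (headV κ ∷ v) (headW κ ∷ w) b) ≡ shifted)
             (corner-closedNM κ N∨M) (countVecs-corner κ v w (N+M≤bound a) ≤-refl) ⟩
      shifted
    ≡⟨ sym (Q≡countVecs (n≤1+n B)) ⟩
      Q M N (v ∷ʳ lastV κ) (w ∷ʳ lastW κ) a (c ℤ.+ tShift κ ∣ v ∣✕)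
    ∎
    where
    open ≡-Reasoning
    B shifted : ℕ
    B = bound M N a
    shifted = countVecs (term? (suc B) a (c ℤ.+ tShift κ ∣ v ∣✕) (v ∷ʳ lastV κ) (w ∷ʳ lastW κ))
    forced : ∀ d → Term (suc B) a c (headV κ ∷ v) (headW κ ∷ w) d → mem d (N + M) ≡ true
    forced d t with Term⇒Contributes d t
    ... | closed , v≡ , w≡ , _ = Closed-N+M closed
      (trans (cong₂ _∨_ (symbol-injectiveˡ (Vecₚ.∷-injectiveˡ v≡)) (symbol-injectiveˡ (Vecₚ.∷-injectiveˡ w≡))) N∨M)

  Q-corner₀ : ∀ κ → bitN κ ∨ bitM κ ≡ true → ∀ (v : Vec Sym m) (w : Vec Sym n) → tShift κ ∣ v ∣✕ ≡ + 0 →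
              Q M N (headV κ ∷ v) (headW κ ∷ w) ≈PS Q M N (v ∷ʳ lastV κ) (w ∷ʳ lastW κ)
  Q-corner₀ κ N∨M v w unshifted a c =
    trans (Q-corner κ N∨M v w a c)
          (cong (Q M N (v ∷ʳ lastV κ) (w ∷ʳ lastW κ) a) (trans (cong (ℤ._+_ c) unshifted) (ℤₚ.+-identityʳ c)))

  Q-○○ : ∀ (v : Vec Sym m) (w : Vec Sym n) →
         Q M N (○ ∷ v) (○ ∷ w) ≈PS tPow (ℤ.- (+ ∣ v ∣✕)) (Q M N (v ∷ʳ ✕) (w ∷ʳ ✕))
                                   ⊕ qMul (tPow (ℤ.- (+ ∣ v ∣✕)) (Q M N (v ∷ʳ ○) (w ∷ʳ ○)))
  Q-○○ v w a c = begin
      Q M N (○ ∷ v) (○ ∷ w) a c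
    ≡⟨ Q≡countVecs (n≤1+n B) ⟩
      countVecs (term? (suc B) a c (○ ∷ v) (○ ∷ w))
    ≡⟨ countVecs-split (term? (suc B) a c (○ ∷ v) (○ ∷ w)) (λ d → mem d (N + M)) ⟩
      countVecs (termNM? (suc B) a c (○ ∷ v) (○ ∷ w) true) + countVecs (termNM? (suc B) a c (○ ∷ v) (○ ∷ w) false)
    ≡⟨ cong₂ _+_ (countVecs-corner ○○∈ v w (N+M≤bound a) ≤-refl) (N+M∉ a ≤-refl) ⟩
      countVecs (term? (suc B) a (c ℤ.+ k) (v ∷ʳ ✕) (w ∷ʳ ✕)) + qMul (tPow (ℤ.- k) Q○) a c
    ≡⟨ cong (_+ qMul (tPow (ℤ.- k) Q○) a c) (trans (sym (Q≡countVecs (n≤1+n B))) (cong (Q✕ a) exponent)) ⟩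
      (tPow (ℤ.- k) Q✕ ⊕ qMul (tPow (ℤ.- k) Q○)) a c
    ∎
    where
    open ≡-Reasoning
    B : ℕ
    B = bound M N a
    k : ℤ
    k = + ∣ v ∣✕
    Q✕ Q○ : PS
    Q✕ = Q M N (v ∷ʳ ✕) (w ∷ʳ ✕)
    Q○ = Q M N (v ∷ʳ ○) (w ∷ʳ ○)
    exponent : c ℤ.+ k ≡ c ℤ.- ℤ.- k
    exponent = cong (ℤ._+_ c) (sym (ℤₚ.neg-involutive k))
    N+M∉ : ∀ a′ → bound M N a′ ≤ B → countVecs (termNM? (suc B) a′ c (○ ∷ v) (○ ∷ w) false) ≡ qMul (tPow (ℤ.- k) Q○) a′ c
    N+M∉ zero _ = countVecs-none (termNM? (suc B) 0 c (○ ∷ v) (○ ∷ w) false) empty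
      where
      empty : ∀ d → ¬ (Term (suc B) 0 c (○ ∷ v) (○ ∷ w) d × mem d (N + M) ≡ false)
      empty d (t , N+M∉d) with Term⇒Contributes d t
      ... | _ , _ , _ , area≡ , _ = 0≢1+n (trans (sym area≡)
        (trans (area-∘suc (mem d) {B} (N+M≤bound a) (mem-trueFrom d)) (cong (λ b → 𝟙 (not b) + area (mem d ∘ suc) (suc B)) N+M∉d)))
    N+M∉ (suc a′) bound≤B = begin
        countVecs (termNM? (suc B) (suc a′) c (○ ∷ v) (○ ∷ w) false)
      ≡⟨ countVecs-corner ○○∉ v w (N+M≤bound a) (≤-trans (bound-mono (n≤1+n a′)) bound≤B) ⟩
        countVecs (term? (suc B) a′ (c ℤ.+ k) (v ∷ʳ ○) (w ∷ʳ ○))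
      ≡⟨ sym (Q≡countVecs (≤-trans (bound-mono (n≤1+n a′)) (≤-trans bound≤B (n≤1+n B)))) ⟩
        Q○ a′ (c ℤ.+ k)
      ≡⟨ cong (Q○ a′) exponent ⟩
        Q○ a′ (c ℤ.- ℤ.- k)
      ∎

mainTheorem9 : (m n : ℕ) (v : Vec Sym m) (w : Vec Sym n) →
    (Q (suc m) (suc n) (○ ∷ v) (○ ∷ w)
      ≈PS tPow (ℤ.- (+ ∣ v ∣✕)) (Q (suc m) (suc n) (v ∷ʳ ✕) (w ∷ʳ ✕))
          ⊕ qMul (tPow (ℤ.- (+ ∣ v ∣✕)) (Q (suc m) (suc n) (v ∷ʳ ○) (w ∷ʳ ○))))
  × (Q (suc m) (suc n) (✕ ∷ v) (○ ∷ w) ≈PS Q (suc m) (suc n) (v ∷ʳ ✕) (w ∷ʳ ●))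
  × (Q (suc m) (suc n) (○ ∷ v) (✕ ∷ w) ≈PS Q (suc m) (suc n) (v ∷ʳ ●) (w ∷ʳ ✕))
  × (Q (suc m) (suc n) (✕ ∷ v) (✕ ∷ w)
      ≈PS tPow (+ ∣ v ∣✕) (Q (suc m) (suc n) (v ∷ʳ ●) (w ∷ʳ ●)))
  × (Q (suc m) (suc n) (● ∷ v) (● ∷ w) ≈PS Q (suc m) (suc n) (v ∷ʳ ●) (w ∷ʳ ●))
mainTheorem9 m n v w =
  Q-○○ m n v w ,
  Q-corner₀ m n ✕○ refl v w refl ,
  Q-corner₀ m n ○✕ refl v w refl ,
  Q-corner m n ✕✕ refl v w ,
  Q-corner₀ m n ●● refl v w refl
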